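{- Let $n$ and $s$ be integers with $\frac{n-2}{2}\le s\le n-1$, and let $H_0$ be a graph on $n$ vertices with $n-s-1$ edges. Then $w_k(H_0)\ge w_k(P_{n,s+1})$ for every $k\ge 1$. Moreover, if $H_0\not\cong P_{n,s+1}$, then $w_k(H_0)>w_k(P_{n,s+1})$ for all $k\ge 2$.
   Context: For a graph $H$, $w_k(H)=\mathbf 1^{\mathsf T}A(H)^k\mathbf 1$ is the total number of walks of length $k$ in $H$, where $A(H)$ is the adjacency matrix and $\mathbf 1$ the all-ones vector. For integers $N\ge c\ge 1$, $P_{N,c}$ denotes the disjoint union of $c+c\lfloor N/c\rfloor-N$ copies of the path $P_{\lfloor N/c\rfloor}$ and $N-c\lfloor N/c\rfloor$ copies of $P_{\lceil N/c\rceil}$, where $P_k$ is the path on $k$ vertices ($P_1$ a single vertex). Under the hypotheses, $P_{n,s+1}$ is a disjoint union of $n-s-1$ copies of $P_2$ and isolated vertices, on $n$ vertices. -}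

module Defs where

open import Data.Nat using (ℕ; zero; suc; _+_; _*_; _∸_; _/_; _≡ᵇ_; NonZero)
open import Data.Bool using (Bool; true; false; _∧_; _∨_; not; if_then_else_; T)
open import Data.Bool.Properties using (∨-comm)
open import Data.Fin using (Fin; zero; suc; toℕ)
open import Data.List using (List; []; _∷_; replicate; _++_)
open import Data.Nat.ListAction using (sum)
open import Data.Product using (Σ; _×_)
open import Function.Bundles using (_↔_; Inverse)
open import Relation.Binary.PropositionalEquality using (_≡_; refl)

∑ : (n : ℕ) → (Fin n → ℕ) → ℕ
∑ zero    f = 0
∑ (suc n) f = f zero + ∑ n (λ i → f (suc i))

⟦_⟧ : Bool → ℕ
⟦ true ⟧  = 1
⟦ false ⟧ = 0

record Graph (n : ℕ) : Set where
  field
    adj    : Fin n → Fin n → Bool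
    sym    : ∀ i j → adj i j ≡ adj j i
    irrefl : ∀ i → adj i i ≡ false
open Graph public

_<ᵇ'_ : ℕ → ℕ → Bool
m <ᵇ' n = Data.Nat._<ᵇ_ m n

edgeCount : ∀ {n} → Graph n → ℕ
edgeCount {n} G = ∑ n (λ i → ∑ n (λ j → ⟦ (toℕ i <ᵇ' toℕ j) ∧ adj G i j ⟧))

-- walksFrom G k v = (A^k 1)_v ; number of walks of length k starting at v.
walksFrom : ∀ {n} → Graph n → ℕ → Fin n → ℕ
walksFrom G zero    v = 1
walksFrom {n} G (suc k) v = ∑ n (λ u → ⟦ adj G v u ⟧ * walksFrom G k u)

w : ∀ {n} → ℕ → Graph n → ℕ
w {n} k G = ∑ n (walksFrom G k)

_≅_ : ∀ {n m} → Graph n → Graph m → Set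
_≅_ {n} {m} G H = Σ (Fin n ↔ Fin m) λ f →
  ∀ i j → adj H (Inverse.to f i) (Inverse.to f j) ≡ adj G i j

-- Path forest: disjoint union of paths with the given numbers of vertices,
-- laid out consecutively on 0,1,…,(sum ls)-1.  Boundaries = positive prefix sums.
prefixSums : ℕ → List ℕ → List ℕ
prefixSums acc []       = []
prefixSums acc (l ∷ ls) = (acc + l) ∷ prefixSums (acc + l) ls

_∈ᵇ_ : ℕ → List ℕ → Bool
x ∈ᵇ []       = false
x ∈ᵇ (y ∷ ys) = (x ≡ᵇ y) ∨ (x ∈ᵇ ys)

pfAdjℕ : List ℕ → ℕ → ℕ → Bool
pfAdjℕ ls i j = ((suc i ≡ᵇ j) ∧ not (j ∈ᵇ prefixSums 0 ls))
              ∨ ((suc j ≡ᵇ i) ∧ not (i ∈ᵇ prefixSums 0 ls))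

private
  suc≢ : ∀ i → (suc i ≡ᵇ i) ≡ false
  suc≢ zero    = refl
  suc≢ (suc i) = suc≢ i

  irr : ∀ ls i → pfAdjℕ ls i i ≡ false
  irr ls i rewrite suc≢ i = refl

pathForest : (ls : List ℕ) → Graph (sum ls)
pathForest ls = record
  { adj    = λ i j → pfAdjℕ ls (toℕ i) (toℕ j)
  ; sym    = λ i j → ∨-comm ((suc (toℕ i) ≡ᵇ toℕ j) ∧ not (toℕ j ∈ᵇ prefixSums 0 ls)) _
  ; irrefl = λ i → irr ls (toℕ i)
  }

-- Lengths of the components of P_{N,c}:
-- (c + c⌊N/c⌋ − N) copies of ⌊N/c⌋ and (N − c⌊N/c⌋) copies of ⌈N/c⌉.
PLengths : (N c : ℕ) → .{{_ : NonZero c}} → List ℕ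
PLengths N c = replicate (c + c * (N / c) ∸ N) (N / c)
            ++ replicate (N ∸ c * (N / c)) ((N + c ∸ 1) / c)

P : (N c : ℕ) → .{{_ : NonZero c}} → Graph (sum (PLengths N c))
P N c = pathForest (PLengths N c)

{-# OPTIONS --safe #-}
-- Every walk of length k ≥ 1 begins with an edge, and a vertex with a neighbour starts walks of every
-- length, so w_k(H) ≥ w_1(H) = 2 e(H); equality holds for all k when H has maximum degree ≤ 1, and a
-- vertex of degree ≥ 2 makes it strict for k ≥ 2. Under the hypotheses on s, P_{n,s+1} consists of
-- isolated vertices and n − s − 1 disjoint edges, so it has maximum degree ≤ 1 and as many edges as
-- H₀. If H₀ also has maximum degree ≤ 1, both are matchings with the same numbers of vertices and
-- edges, hence isomorphic; otherwise the inequality is strict.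
module Submission where

open import Defs hiding (sym)
open import Data.Nat using (ℕ; zero; suc; _+_; _*_; _∸_; _≤_; _<_; z≤n; s≤s; z<s; _≡ᵇ_; _<ᵇ_; _/_; NonZero)
open import Data.Nat.Properties
open import Data.Nat.DivMod using (m/n≡1+[m∸n]/n; m<n⇒m/n≡0; n/n≡1)
open import Data.Bool using (true; false; _∧_; _∨_; not)
open import Data.Bool.Properties using (∨-comm)
open import Data.Fin using (Fin; zero; suc; toℕ; punchIn; punchOut)
open import Data.Fin.Properties using (toℕ-injective; punchIn-punchOut; any?) renaming (_≟_ to _≟ᶠ_)
open import Data.Fin.Permutation using (Permutation; insert; insert-punchIn; _⟨$⟩ʳ_; _⟨$⟩ˡ_; inverseˡ)
import Data.Fin.Permutation as Perm
import Data.Fin.Properties as Fin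
open import Data.List using (List; []; _∷_; replicate; _++_)
open import Data.List.Properties using (++-identityʳ)
open import Data.Nat.ListAction using (sum)
open import Data.Product using (Σ; _×_; _,_; proj₁; proj₂)
open import Data.Sum using (inj₁; inj₂)
open import Data.Empty using (⊥-elim)
open import Relation.Nullary using (¬_; yes; no)
open import Relation.Binary.PropositionalEquality
open import Relation.Binary.Definitions using (tri<; tri≈; tri>)
open import Function using (_∘_)
open import Data.Nat.Tactic.RingSolver using (solve-∀)
open import Algebra.Properties.CommutativeSemigroup +-commutativeSemigroup using (interchange; x∙yz≈y∙xz)

∑-cong : ∀ n {f g : Fin n → ℕ} → (∀ i → f i ≡ g i) → ∑ n f ≡ ∑ n g
∑-cong zero    f≗g = refl
∑-cong (suc n) f≗g = cong₂ _+_ (f≗g zero) (∑-cong n (f≗g ∘ suc))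

∑-mono-≤ : ∀ n {f g : Fin n → ℕ} → (∀ i → f i ≤ g i) → ∑ n f ≤ ∑ n g
∑-mono-≤ zero    f≤g = z≤n
∑-mono-≤ (suc n) f≤g = +-mono-≤ (f≤g zero) (∑-mono-≤ n (f≤g ∘ suc))

∑-mono-< : ∀ n {f g : Fin n → ℕ} → (∀ i → f i ≤ g i) → ∀ i → f i < g i → ∑ n f < ∑ n g
∑-mono-< (suc n) f≤g zero    fi<gi = +-mono-<-≤ fi<gi (∑-mono-≤ n (f≤g ∘ suc))
∑-mono-< (suc n) f≤g (suc i) fi<gi = +-mono-≤-< (f≤g zero) (∑-mono-< n (f≤g ∘ suc) i fi<gi)

∑-0 : ∀ n → ∑ n (λ _ → 0) ≡ 0
∑-0 zero    = refl
∑-0 (suc n) = ∑-0 n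

∑-1 : ∀ n → ∑ n (λ _ → 1) ≡ n
∑-1 zero    = refl
∑-1 (suc n) = cong suc (∑-1 n)

term≤∑ : ∀ n (f : Fin n → ℕ) i → f i ≤ ∑ n f
term≤∑ (suc n) f zero    = m≤m+n _ _
term≤∑ (suc n) f (suc i) = ≤-trans (term≤∑ n (f ∘ suc) i) (m≤n+m _ _)

∑-positive : ∀ n (f : Fin n → ℕ) → 0 < ∑ n f → Σ (Fin n) λ i → 0 < f i
∑-positive (suc n) f ∑>0 with f zero in eq
... | suc _ = zero , subst (0 <_) (sym eq) z<s
... | zero  with ∑-positive n (f ∘ suc) ∑>0
...   | i , fi>0 = suc i , fi>0

∑-punchIn : ∀ n (f : Fin (suc n) → ℕ) x → ∑ (suc n) f ≡ f x + ∑ n (f ∘ punchIn x)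
∑-punchIn n       f zero    = refl
∑-punchIn (suc n) f (suc x) = begin
  f zero + ∑ (suc n) (f ∘ suc)                      ≡⟨ cong (f zero +_) (∑-punchIn n (f ∘ suc) x) ⟩
  f zero + (f (suc x) + ∑ n (f ∘ suc ∘ punchIn x))  ≡⟨ x∙yz≈y∙xz (f zero) (f (suc x)) _ ⟩
  f (suc x) + (f zero + ∑ n (f ∘ suc ∘ punchIn x))  ∎
  where open ≡-Reasoning

∑-pair : ∀ n (f : Fin n → ℕ) {i j} → i ≢ j → f i + f j ≤ ∑ n f
∑-pair (suc n) f {zero}  {zero}  0≢0 = ⊥-elim (0≢0 refl)
∑-pair (suc n) f {zero}  {suc j} _   = +-monoʳ-≤ (f zero) (term≤∑ n (f ∘ suc) j)
∑-pair (suc n) f {suc i} {zero}  _   = ≤-trans (≤-reflexive (+-comm (f (suc i)) (f zero)))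
                                               (+-monoʳ-≤ (f zero) (term≤∑ n (f ∘ suc) i))
∑-pair (suc n) f {suc i} {suc j} i≢j = ≤-trans (∑-pair n (f ∘ suc) (i≢j ∘ cong suc)) (m≤n+m _ _)

∑-distrib-+ : ∀ n (f g : Fin n → ℕ) → ∑ n (λ i → f i + g i) ≡ ∑ n f + ∑ n g
∑-distrib-+ zero    f g = refl
∑-distrib-+ (suc n) f g = begin
  f zero + g zero + ∑ n (λ i → f (suc i) + g (suc i))
    ≡⟨ cong (f zero + g zero +_) (∑-distrib-+ n (f ∘ suc) (g ∘ suc)) ⟩
  f zero + g zero + (∑ n (f ∘ suc) + ∑ n (g ∘ suc))
    ≡⟨ interchange (f zero) (g zero) _ _ ⟩
  f zero + ∑ n (f ∘ suc) + (g zero + ∑ n (g ∘ suc)) ∎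
  where open ≡-Reasoning

∑-comm : ∀ m n (f : Fin m → Fin n → ℕ) → ∑ m (λ i → ∑ n (f i)) ≡ ∑ n (λ j → ∑ m (λ i → f i j))
∑-comm zero    n f = sym (∑-0 n)
∑-comm (suc m) n f = begin
  ∑ n (f zero) + ∑ m (λ i → ∑ n (f (suc i)))
    ≡⟨ cong (∑ n (f zero) +_) (∑-comm m n (f ∘ suc)) ⟩
  ∑ n (f zero) + ∑ n (λ j → ∑ m (λ i → f (suc i) j))
    ≡⟨ ∑-distrib-+ n (f zero) _ ⟨
  ∑ n (λ j → f zero j + ∑ m (λ i → f (suc i) j)) ∎
  where open ≡-Reasoning

degree : ∀ {n} → Graph n → Fin n → ℕ
degree {n} G v = ∑ n (λ u → ⟦ adj G v u ⟧)

degreeSum : ∀ {n} → Graph n → ℕ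
degreeSum {n} G = ∑ n (degree G)

MaxDegree≤1 : ∀ {n} → Graph n → Set
MaxDegree≤1 G = ∀ v → degree G v ≤ 1

module _ {n} (G : Graph n) where

  adj-sym-true : ∀ {u v} → adj G u v ≡ true → adj G v u ≡ true
  adj-sym-true {u} {v} uv = trans (Graph.sym G v u) uv

  neighbour : ∀ v → 0 < degree G v → Σ (Fin n) λ u → adj G v u ≡ true
  neighbour v deg>0 with ∑-positive n _ deg>0
  ... | u , _ with adj G v u in uv
  ...   | true = u , uv

  1≤walksFrom : ∀ k {u v} → adj G u v ≡ true → 1 ≤ walksFrom G k u
  1≤walksFrom zero    uv = s≤s z≤n
  1≤walksFrom (suc k) {u} {v} uv = ≤-trans first-step (term≤∑ n _ v)
    where
    first-step : 1 ≤ ⟦ adj G u v ⟧ * walksFrom G k v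
    first-step rewrite uv = ≤-trans (1≤walksFrom k (adj-sym-true uv)) (m≤m+n _ 0)

  degree-term≤ : ∀ k v u → ⟦ adj G v u ⟧ ≤ ⟦ adj G v u ⟧ * walksFrom G k u
  degree-term≤ k v u with adj G v u in vu
  ... | true  = ≤-trans (1≤walksFrom k (adj-sym-true vu)) (m≤m+n _ 0)
  ... | false = z≤n

  degree≤walksFrom : ∀ k v → degree G v ≤ walksFrom G (suc k) v
  degree≤walksFrom k v = ∑-mono-≤ n (degree-term≤ k v)

  degreeSum≤w : ∀ k → degreeSum G ≤ w (suc k) G
  degreeSum≤w k = ∑-mono-≤ n (degree≤walksFrom k)

  degreeSum<w : ∀ v → 2 ≤ degree G v → ∀ k → degreeSum G < w (2 + k) G
  -- v contributes walksFrom G (1 + k) v ≥ degree G v ≥ 2 to walksFrom G (2 + k) u, but only 1 to degree G u.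
  degreeSum<w v deg≥2 k with neighbour v (≤-trans (s≤s z≤n) deg≥2)
  ... | u , vu = ∑-mono-< n (degree≤walksFrom (suc k)) u (∑-mono-< n (degree-term≤ (suc k) u) v term<)
    where
    term< : ⟦ adj G u v ⟧ < ⟦ adj G u v ⟧ * walksFrom G (suc k) v
    term< rewrite adj-sym-true vu | +-identityʳ (walksFrom G (suc k) v) = ≤-trans deg≥2 (degree≤walksFrom k v)

  module _ (maxDegree≤1 : MaxDegree≤1 G) where

    walksFrom≤1 : ∀ k v → walksFrom G k v ≤ 1
    walksFrom≤degree : ∀ k v → walksFrom G (suc k) v ≤ degree G v
    walksFrom≤1 zero    v = ≤-refl
    walksFrom≤1 (suc k) v = ≤-trans (walksFrom≤degree k v) (maxDegree≤1 v)
    walksFrom≤degree k v = ∑-mono-≤ n λ u →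
      ≤-trans (*-monoʳ-≤ ⟦ adj G v u ⟧ (walksFrom≤1 k u)) (≤-reflexive (*-identityʳ _))

    w≤degreeSum : ∀ k → w (suc k) G ≤ degreeSum G
    w≤degreeSum k = ∑-mono-≤ n (walksFrom≤degree k)

<ᵇ-true : ∀ {m n} → m < n → (m <ᵇ n) ≡ true
<ᵇ-true {zero}  (s≤s _)   = refl
<ᵇ-true {suc m} (s≤s m<n) = <ᵇ-true m<n

<ᵇ-false : ∀ {m n} → n ≤ m → (m <ᵇ n) ≡ false
<ᵇ-false {m}     z≤n       = refl
<ᵇ-false {suc m} (s≤s n≤m) = <ᵇ-false n≤m

module _ {n} (G : Graph n) where

  adjacency-by-order : ∀ i j →
    ⟦ adj G i j ⟧ ≡ ⟦ (toℕ i <ᵇ' toℕ j) ∧ adj G i j ⟧ + ⟦ (toℕ j <ᵇ' toℕ i) ∧ adj G j i ⟧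
  adjacency-by-order i j with <-cmp (toℕ i) (toℕ j)
  ... | tri< i<j _ _ rewrite <ᵇ-true i<j | <ᵇ-false (<⇒≤ i<j) = sym (+-identityʳ _)
  ... | tri> _ _ j<i rewrite <ᵇ-false (<⇒≤ j<i) | <ᵇ-true j<i | Graph.sym G j i = refl
  ... | tri≈ _ i≡j _ rewrite toℕ-injective i≡j | <ᵇ-false (≤-refl {toℕ j}) | Graph.irrefl G j = refl

  handshake : degreeSum G ≡ 2 * edgeCount G
  handshake = begin
    degreeSum G
      ≡⟨ ∑-cong n (λ i → ∑-cong n (adjacency-by-order i)) ⟩
    ∑ n (λ i → ∑ n (λ j → ascendingEdge i j + ascendingEdge j i))
      ≡⟨ ∑-cong n (λ i → ∑-distrib-+ n (ascendingEdge i) (λ j → ascendingEdge j i)) ⟩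
    ∑ n (λ i → ∑ n (ascendingEdge i) + ∑ n (λ j → ascendingEdge j i))
      ≡⟨ ∑-distrib-+ n _ _ ⟩
    edgeCount G + ∑ n (λ i → ∑ n (λ j → ascendingEdge j i))
      ≡⟨ cong (edgeCount G +_) (∑-comm n n (λ i j → ascendingEdge j i)) ⟩
    edgeCount G + edgeCount G
      ≡⟨ cong (edgeCount G +_) (+-identityʳ _) ⟨
    2 * edgeCount G ∎
    where
    open ≡-Reasoning
    ascendingEdge : Fin n → Fin n → ℕ
    ascendingEdge i j = ⟦ (toℕ i <ᵇ' toℕ j) ∧ adj G i j ⟧

removeVertex : ∀ {n} → Graph (suc n) → Fin (suc n) → Graph n
removeVertex G x = record
  { adj    = λ i j → adj G (punchIn x i) (punchIn x j)
  ; sym    = λ i j → Graph.sym G (punchIn x i) (punchIn x j)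
  ; irrefl = λ i → Graph.irrefl G (punchIn x i)
  }

data PunchInView {n} (x : Fin (suc n)) : Fin (suc n) → Set where
  at        : PunchInView x x
  punchedIn : ∀ k → PunchInView x (punchIn x k)

punchInView : ∀ {n} (x k : Fin (suc n)) → PunchInView x k
punchInView x k with x ≟ᶠ k
... | yes refl = at
... | no  x≢k  = subst (PunchInView x) (punchIn-punchOut x≢k) (punchedIn (punchOut x≢k))

insert-at : ∀ {m n} (x : Fin (suc m)) (x′ : Fin (suc n)) (π : Permutation m n) → insert x x′ π ⟨$⟩ʳ x ≡ x′
insert-at x x′ π with x ≟ᶠ x
... | yes _   = refl
... | no  x≢x = ⊥-elim (x≢x refl)

≅-extend : ∀ {n n′} (G : Graph (suc n)) (G′ : Graph (suc n′)) x x′ →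
           ((π , _) : removeVertex G x ≅ removeVertex G′ x′) →
           (∀ j → adj G′ x′ (punchIn x′ (π ⟨$⟩ʳ j)) ≡ adj G x (punchIn x j)) →
           Σ (G ≅ G′) λ (F , _) → F ⟨$⟩ʳ x ≡ x′
≅-extend G G′ x x′ (π , π-preserves) x-neighbours = (F , F-preserves) , insert-at x x′ π
  where
  F = insert x x′ π
  F-preserves : ∀ i j → adj G′ (F ⟨$⟩ʳ i) (F ⟨$⟩ʳ j) ≡ adj G i j
  F-preserves i j with punchInView x i | punchInView x j
  ... | at | at rewrite insert-at x x′ π = trans (Graph.irrefl G′ x′) (sym (Graph.irrefl G x))
  ... | at | punchedIn j₀ rewrite insert-at x x′ π | insert-punchIn x x′ π j₀ = x-neighbours j₀
  ... | punchedIn i₀ | at rewrite insert-at x x′ π | insert-punchIn x x′ π i₀ =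
        trans (Graph.sym G′ _ x′) (trans (x-neighbours i₀) (Graph.sym G x _))
  ... | punchedIn i₀ | punchedIn j₀ rewrite insert-punchIn x x′ π i₀ | insert-punchIn x x′ π j₀ =
        π-preserves i₀ j₀

module _ {n} (G : Graph (suc n)) (x : Fin (suc n)) where

  degree-punchIn : ∀ i → degree G (punchIn x i) ≡ ⟦ adj G (punchIn x i) x ⟧ + degree (removeVertex G x) i
  degree-punchIn i = ∑-punchIn n (λ u → ⟦ adj G (punchIn x i) u ⟧) x

  degree≡∑-punchIn : degree G x ≡ ∑ n (λ i → ⟦ adj G x (punchIn x i) ⟧)
  degree≡∑-punchIn rewrite ∑-punchIn n (λ u → ⟦ adj G x u ⟧) x | Graph.irrefl G x = refl

  degreeSum-removeVertex : degreeSum G ≡ degree G x + (degree G x + degreeSum (removeVertex G x))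
  degreeSum-removeVertex = begin
    degreeSum G
      ≡⟨ ∑-punchIn n (degree G) x ⟩
    degree G x + ∑ n (degree G ∘ punchIn x)
      ≡⟨ cong (degree G x +_) (∑-cong n degree-punchIn) ⟩
    degree G x + ∑ n (λ i → ⟦ adj G (punchIn x i) x ⟧ + degree (removeVertex G x) i)
      ≡⟨ cong (degree G x +_) (∑-distrib-+ n _ _) ⟩
    degree G x + (∑ n (λ i → ⟦ adj G (punchIn x i) x ⟧) + degreeSum (removeVertex G x))
      ≡⟨ cong (λ d → degree G x + (d + degreeSum (removeVertex G x))) x-degree ⟩
    degree G x + (degree G x + degreeSum (removeVertex G x)) ∎
    where
    open ≡-Reasoning
    x-degree : ∑ n (λ i → ⟦ adj G (punchIn x i) x ⟧) ≡ degree G x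
    x-degree = trans (∑-cong n (λ i → cong ⟦_⟧ (Graph.sym G _ x))) (sym degree≡∑-punchIn)

  degreeSum-remove-isolated : degree G x ≡ 0 → degreeSum G ≡ degreeSum (removeVertex G x)
  degreeSum-remove-isolated x-isolated rewrite degreeSum-removeVertex | x-isolated = refl

  maxDegree≤1-removeVertex : MaxDegree≤1 G → MaxDegree≤1 (removeVertex G x)
  maxDegree≤1-removeVertex maxDegree≤1 i =
    ≤-trans (m≤n+m _ _) (subst (_≤ 1) (degree-punchIn i) (maxDegree≤1 (punchIn x i)))

  isolated-nonadjacent : degree G x ≡ 0 → ∀ j → adj G x j ≡ false
  isolated-nonadjacent x-isolated j with adj G x j in xj
  ... | false = refl
  ... | true  = ⊥-elim (1+n≰n (subst (1 ≤_) x-isolated 1≤degree))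
    where
    1≤degree : 1 ≤ degree G x
    1≤degree = subst (_≤ degree G x) (cong ⟦_⟧ xj) (term≤∑ (suc n) (λ u → ⟦ adj G x u ⟧) j)

≅-extend-isolated : ∀ {n n′} (G : Graph (suc n)) (G′ : Graph (suc n′)) {x x′} →
                    degree G x ≡ 0 → degree G′ x′ ≡ 0 → removeVertex G x ≅ removeVertex G′ x′ →
                    Σ (G ≅ G′) λ (F , _) → F ⟨$⟩ʳ x ≡ x′
≅-extend-isolated G G′ {x} {x′} x-isolated x′-isolated F₀ = ≅-extend G G′ x x′ F₀ λ j →
  trans (isolated-nonadjacent G′ x′ x′-isolated _) (sym (isolated-nonadjacent G x x-isolated _))

module _ {n} (G : Graph n) (maxDegree≤1 : MaxDegree≤1 G) where

  degreeSum≤order : degreeSum G ≤ n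
  degreeSum≤order = subst (degreeSum G ≤_) (∑-1 n) (∑-mono-≤ n maxDegree≤1)

  non-isolated⇒degree≡1 : ∀ {v} → degree G v ≢ 0 → degree G v ≡ 1
  non-isolated⇒degree≡1 {v} v-non-isolated = ≤-antisym (maxDegree≤1 v) (n≢0⇒n>0 v-non-isolated)

  unique-neighbour : ∀ {x y} → adj G x y ≡ true → ∀ z → z ≢ y → adj G x z ≡ false
  unique-neighbour {x} {y} xy z z≢y with adj G x z in xz
  ... | false = refl
  ... | true  = ⊥-elim (1+n≰n (≤-trans 2≤degree (maxDegree≤1 x)))
    where
    2≤degree : 2 ≤ degree G x
    2≤degree = ≤-trans (+-mono-≤ (≤-reflexive (cong ⟦_⟧ (sym xy))) (≤-reflexive (cong ⟦_⟧ (sym xz))))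
                       (∑-pair n (λ u → ⟦ adj G x u ⟧) (z≢y ∘ sym))

order≤degreeSum : ∀ {n} (G : Graph n) → (∀ v → degree G v ≢ 0) → n ≤ degreeSum G
order≤degreeSum {n} G no-isolated = subst (_≤ degreeSum G) (∑-1 n) (∑-mono-≤ n (n≢0⇒n>0 ∘ no-isolated))

partner-of-zero : ∀ {m} (G : Graph (suc m)) → 0 < degree G zero → Σ (Fin m) λ y → adj G zero (suc y) ≡ true
partner-of-zero G deg>0 with neighbour G zero deg>0
... | suc y , 0y = y , 0y
... | zero  , loop with trans (sym loop) (Graph.irrefl G zero)
...   | ()

module _ {m} (G : Graph (suc (suc m))) (maxDegree≤1 : MaxDegree≤1 G) {y} (0y : adj G zero (suc y) ≡ true) where

  partner-isolated : degree (removeVertex G zero) y ≡ 0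
  partner-isolated = n≤0⇒n≡0 (≤-pred (subst (_≤ 1) y-degree (maxDegree≤1 (suc y))))
    where
    y-degree : degree G (suc y) ≡ 1 + degree (removeVertex G zero) y
    y-degree rewrite degree-punchIn G zero y | adj-sym-true G 0y = refl

  degreeSum-remove-edge : degree G zero ≡ 1 → degreeSum G ≡ 2 + degreeSum (removeVertex (removeVertex G zero) y)
  degreeSum-remove-edge 0-degree
    rewrite degreeSum-removeVertex G zero | 0-degree
          | degreeSum-remove-isolated (removeVertex G zero) y partner-isolated = refl

isolated-vs-non-isolated : ∀ {n} (G G′ : Graph (suc n)) → MaxDegree≤1 G → degreeSum G ≡ degreeSum G′ →
                           ∀ {x} → degree G x ≡ 0 → ¬ (∀ v → degree G′ v ≢ 0)
isolated-vs-non-isolated {n} G G′ maxDegree≤1 G≡G′ {x} x-isolated no-isolated′ = 1+n≰n (begin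
  suc n                          ≤⟨ order≤degreeSum G′ no-isolated′ ⟩
  degreeSum G′                   ≡⟨ trans (sym G≡G′) (degreeSum-remove-isolated G x x-isolated) ⟩
  degreeSum (removeVertex G x)   ≤⟨ degreeSum≤order (removeVertex G x) (maxDegree≤1-removeVertex G x maxDegree≤1) ⟩
  n                              ∎)
  where open ≤-Reasoning

matchings-≅ : ∀ n (G G′ : Graph n) → MaxDegree≤1 G → MaxDegree≤1 G′ → degreeSum G ≡ degreeSum G′ → G ≅ G′
perfect-matchings-≅ : ∀ n (G G′ : Graph (suc n)) → MaxDegree≤1 G → MaxDegree≤1 G′ → degreeSum G ≡ degreeSum G′ →
                      (∀ v → degree G v ≢ 0) → (∀ v → degree G′ v ≢ 0) → G ≅ G′

matchings-≅ zero    G G′ _ _ _ = Perm.id , λ ()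
matchings-≅ (suc n) G G′ md md′ G≡G′ with any? (λ x → degree G x ≟ 0) | any? (λ x → degree G′ x ≟ 0)
... | yes (x , x-isolated) | yes (x′ , x′-isolated) =
  proj₁ (≅-extend-isolated G G′ x-isolated x′-isolated
          (matchings-≅ n (removeVertex G x) (removeVertex G′ x′)
                         (maxDegree≤1-removeVertex G x md) (maxDegree≤1-removeVertex G′ x′ md′) removed≡))
  where
  removed≡ : degreeSum (removeVertex G x) ≡ degreeSum (removeVertex G′ x′)
  removed≡ = trans (sym (degreeSum-remove-isolated G x x-isolated))
                   (trans G≡G′ (degreeSum-remove-isolated G′ x′ x′-isolated))
... | yes (_ , x-isolated) | no none′ =
  ⊥-elim (isolated-vs-non-isolated G G′ md G≡G′ x-isolated (λ v d → none′ (v , d)))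
... | no none | yes (_ , x′-isolated) =
  ⊥-elim (isolated-vs-non-isolated G′ G md′ (sym G≡G′) x′-isolated (λ v d → none (v , d)))
... | no none | no none′ =
  perfect-matchings-≅ n G G′ md md′ G≡G′ (λ v d → none (v , d)) (λ v d → none′ (v , d))

perfect-matchings-≅ n G G′ md md′ G≡G′ perfect perfect′
  with partner-of-zero G (n≢0⇒n>0 (perfect zero)) | partner-of-zero G′ (n≢0⇒n>0 (perfect′ zero))
-- The edges {0, y} and {0, y′} are components; delete them, match the rest, then extend at y and at 0.
perfect-matchings-≅ (suc m) G G′ md md′ G≡G′ perfect perfect′ | y , 0y | y′ , 0y′ =
  proj₁ (≅-extend G G′ zero zero F₁ zero-neighbours)
  where
  G₁ = removeVertex G zero
  G₁′ = removeVertex G′ zero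
  removed≡ : degreeSum (removeVertex G₁ y) ≡ degreeSum (removeVertex G₁′ y′)
  removed≡ = +-cancelˡ-≡ 2 _ _ (begin
    2 + degreeSum (removeVertex G₁ y)   ≡⟨ degreeSum-remove-edge G md 0y 0-degree ⟨
    degreeSum G                         ≡⟨ G≡G′ ⟩
    degreeSum G′                        ≡⟨ degreeSum-remove-edge G′ md′ 0y′ 0-degree′ ⟩
    2 + degreeSum (removeVertex G₁′ y′) ∎)
    where
    open ≡-Reasoning
    0-degree  = non-isolated⇒degree≡1 G md (perfect zero)
    0-degree′ = non-isolated⇒degree≡1 G′ md′ (perfect′ zero)
  F₂ : removeVertex G₁ y ≅ removeVertex G₁′ y′
  F₂ = matchings-≅ m (removeVertex G₁ y) (removeVertex G₁′ y′)
                     (maxDegree≤1-removeVertex G₁ y (maxDegree≤1-removeVertex G zero md))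
                     (maxDegree≤1-removeVertex G₁′ y′ (maxDegree≤1-removeVertex G′ zero md′)) removed≡
  F₁,y↦y′ = ≅-extend-isolated G₁ G₁′ (partner-isolated G md 0y) (partner-isolated G′ md′ 0y′) F₂
  F₁ = proj₁ F₁,y↦y′
  π = proj₁ F₁
  zero-neighbours : ∀ j → adj G′ zero (suc (π ⟨$⟩ʳ j)) ≡ adj G zero (suc j)
  zero-neighbours j with j ≟ᶠ y
  ... | yes refl rewrite proj₂ F₁,y↦y′ = trans 0y′ (sym 0y)
  ... | no  j≢y  = trans (unique-neighbour G′ md′ 0y′ _ (πj≢y′ ∘ Fin.suc-injective))
                         (sym (unique-neighbour G md 0y _ (j≢y ∘ Fin.suc-injective)))
    where
    πj≢y′ : π ⟨$⟩ʳ j ≢ y′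
    πj≢y′ πj≡y′ = j≢y (begin
      j                        ≡⟨ inverseˡ π ⟨
      π ⟨$⟩ˡ (π ⟨$⟩ʳ j)         ≡⟨ cong (π ⟨$⟩ˡ_) (trans πj≡y′ (sym (proj₂ F₁,y↦y′))) ⟩
      π ⟨$⟩ˡ (π ⟨$⟩ʳ y)         ≡⟨ inverseˡ π ⟩
      y                        ∎)
      where open ≡-Reasoning

∈ᵇ-prefixSums-suc : ∀ x acc ls → suc x ∈ᵇ prefixSums (suc acc) ls ≡ x ∈ᵇ prefixSums acc ls
∈ᵇ-prefixSums-suc x acc []       = refl
∈ᵇ-prefixSums-suc x acc (l ∷ ls) = cong ((x ≡ᵇ acc + l) ∨_) (∈ᵇ-prefixSums-suc x (acc + l) ls)

0∉prefixSums-suc : ∀ acc ls → 0 ∈ᵇ prefixSums (suc acc) ls ≡ false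
0∉prefixSums-suc acc []       = refl
0∉prefixSums-suc acc (l ∷ ls) = 0∉prefixSums-suc (acc + l) ls

pfAdjℕ-sym : ∀ ls i j → pfAdjℕ ls i j ≡ pfAdjℕ ls j i
pfAdjℕ-sym ls i j = ∨-comm ((suc i ≡ᵇ j) ∧ not (j ∈ᵇ prefixSums 0 ls)) _

-- Deleting vertex 0 of a path forest shortens its first path by one.
pfAdjℕ-suc : ∀ l ls i j → pfAdjℕ (suc l ∷ ls) (suc i) (suc j) ≡ pfAdjℕ (l ∷ ls) i j
pfAdjℕ-suc l ls i j rewrite ∈ᵇ-prefixSums-suc i l ls | ∈ᵇ-prefixSums-suc j l ls = refl

pfAdjℕ-0∷ : ∀ ls i j → pfAdjℕ (0 ∷ ls) i j ≡ pfAdjℕ ls i j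
pfAdjℕ-0∷ ls zero    zero    = refl
pfAdjℕ-0∷ ls zero    (suc j) = refl
pfAdjℕ-0∷ ls (suc i) zero    = refl
pfAdjℕ-0∷ ls (suc i) (suc j) = refl

pfAdjℕ-1∷-0 : ∀ ls j → pfAdjℕ (1 ∷ ls) 0 j ≡ false
pfAdjℕ-1∷-0 ls zero          = refl
pfAdjℕ-1∷-0 ls (suc zero)    = refl
pfAdjℕ-1∷-0 ls (suc (suc j)) = refl

pfAdjℕ-2∷-0 : ∀ ls j → pfAdjℕ (2 ∷ ls) 0 j ≡ (j ≡ᵇ 1)
pfAdjℕ-2∷-0 ls zero          = refl
pfAdjℕ-2∷-0 ls (suc zero)    rewrite ∈ᵇ-prefixSums-suc 0 1 ls | 0∉prefixSums-suc 0 ls = refl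
pfAdjℕ-2∷-0 ls (suc (suc j)) = refl

pfDegree : List ℕ → ℕ → ℕ
pfDegree ls x = ∑ (sum ls) (λ j → ⟦ pfAdjℕ ls x (toℕ j) ⟧)

module _ (ls : List ℕ) where

  pfDegree-suc : ∀ l x →
    pfDegree (suc l ∷ ls) (suc x) ≡ ⟦ pfAdjℕ (suc l ∷ ls) 0 (suc x) ⟧ + pfDegree (l ∷ ls) x
  pfDegree-suc l x = cong₂ _+_ (cong ⟦_⟧ (pfAdjℕ-sym (suc l ∷ ls) (suc x) 0))
                               (∑-cong (sum (l ∷ ls)) (λ j → cong ⟦_⟧ (pfAdjℕ-suc l ls x (toℕ j))))

  pfDegree-0∷ : ∀ x → pfDegree (0 ∷ ls) x ≡ pfDegree ls x
  pfDegree-0∷ x = ∑-cong (sum ls) (λ j → cong ⟦_⟧ (pfAdjℕ-0∷ ls x (toℕ j)))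

  pfDegree-1∷-0 : pfDegree (1 ∷ ls) 0 ≡ 0
  pfDegree-1∷-0 = trans (∑-cong (sum (1 ∷ ls)) (λ j → cong ⟦_⟧ (pfAdjℕ-1∷-0 ls (toℕ j)))) (∑-0 (sum (1 ∷ ls)))

  pfDegree-1∷-suc : ∀ x → pfDegree (1 ∷ ls) (suc x) ≡ pfDegree ls x
  pfDegree-1∷-suc x = trans (pfDegree-suc 0 x) (cong₂ _+_ (cong ⟦_⟧ (pfAdjℕ-1∷-0 ls (suc x))) (pfDegree-0∷ x))

  pfDegree-2∷-0 : pfDegree (2 ∷ ls) 0 ≡ 1
  pfDegree-2∷-0 = trans (∑-cong (sum (2 ∷ ls)) (λ j → cong ⟦_⟧ (pfAdjℕ-2∷-0 ls (toℕ j)))) (cong suc (∑-0 (sum ls)))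

  pfDegree-2∷-1 : pfDegree (2 ∷ ls) 1 ≡ 1
  pfDegree-2∷-1 = trans (pfDegree-suc 1 0) (cong₂ _+_ (cong ⟦_⟧ (pfAdjℕ-2∷-0 ls 1)) pfDegree-1∷-0)

  pfDegree-2∷-suc-suc : ∀ x → pfDegree (2 ∷ ls) (suc (suc x)) ≡ pfDegree ls x
  pfDegree-2∷-suc-suc x =
    trans (pfDegree-suc 1 (suc x)) (cong₂ _+_ (cong ⟦_⟧ (pfAdjℕ-2∷-0 ls (suc (suc x)))) (pfDegree-1∷-suc x))

matchingLengths : ℕ → ℕ → List ℕ
matchingLengths a b = replicate a 1 ++ replicate b 2

matchingLengths-maxDegree≤1 : ∀ a b → MaxDegree≤1 (pathForest (matchingLengths a b))
matchingLengths-maxDegree≤1 a b i = pfDegree≤1 a b (toℕ i)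
  where
  pfDegree≤1 : ∀ a b x → pfDegree (matchingLengths a b) x ≤ 1
  pfDegree≤1 (suc a) b zero                = ≤-trans (≤-reflexive (pfDegree-1∷-0 (matchingLengths a b))) z≤n
  pfDegree≤1 (suc a) b (suc x)             =
    ≤-trans (≤-reflexive (pfDegree-1∷-suc (matchingLengths a b) x)) (pfDegree≤1 a b x)
  pfDegree≤1 zero    zero    x             = z≤n
  pfDegree≤1 zero    (suc b) zero          = ≤-reflexive (pfDegree-2∷-0 (matchingLengths 0 b))
  pfDegree≤1 zero    (suc b) (suc zero)    = ≤-reflexive (pfDegree-2∷-1 (matchingLengths 0 b))
  pfDegree≤1 zero    (suc b) (suc (suc x)) =
    ≤-trans (≤-reflexive (pfDegree-2∷-suc-suc (matchingLengths 0 b) x)) (pfDegree≤1 zero b x)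

matchingLengths-degreeSum : ∀ a b → degreeSum (pathForest (matchingLengths a b)) ≡ 2 * b
matchingLengths-degreeSum (suc a) b =
  trans (cong₂ _+_ (pfDegree-1∷-0 ls) (∑-cong (sum ls) (λ i → pfDegree-1∷-suc ls (toℕ i))))
        (matchingLengths-degreeSum a b)
  where ls = matchingLengths a b
matchingLengths-degreeSum zero zero    = refl
matchingLengths-degreeSum zero (suc b) = begin
  pfDegree (2 ∷ ls) 0 + (pfDegree (2 ∷ ls) 1 + ∑ (sum ls) (λ i → pfDegree (2 ∷ ls) (suc (suc (toℕ i)))))
    ≡⟨ cong₂ _+_ (pfDegree-2∷-0 ls)
             (cong₂ _+_ (pfDegree-2∷-1 ls) (∑-cong (sum ls) (λ i → pfDegree-2∷-suc-suc ls (toℕ i)))) ⟩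
  2 + degreeSum (pathForest (matchingLengths 0 b))
    ≡⟨ cong (2 +_) (matchingLengths-degreeSum zero b) ⟩
  2 + 2 * b
    ≡⟨ *-suc 2 b ⟨
  2 * suc b ∎
  where
  open ≡-Reasoning
  ls = matchingLengths 0 b

sum-matchingLengths : ∀ a b → sum (matchingLengths a b) ≡ a + 2 * b
sum-matchingLengths (suc a) b    = cong suc (sum-matchingLengths a b)
sum-matchingLengths zero zero    = refl
sum-matchingLengths zero (suc b) = trans (cong (2 +_) (sum-matchingLengths zero b)) (sym (*-suc 2 b))

[n+m]/n≡1+m/n : ∀ n .{{_ : NonZero n}} m → (n + m) / n ≡ suc (m / n)
[n+m]/n≡1+m/n n m = trans (m/n≡1+[m∸n]/n (m≤m+n n m)) (cong (λ k → suc (k / n)) (m+n∸m≡n n m))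

PLengths-matchingLengths : ∀ s b → b ≤ suc s → PLengths (suc s + b) (suc s) ≡ matchingLengths (suc s ∸ b) b
PLengths-matchingLengths s b b≤c with m≤n⇒m<n∨m≡n b≤c
... | inj₁ b<c = cong₂ _++_ (cong₂ replicate isolated-count q≡1)
                           (trans (cong (λ k → replicate k ((c + b + c ∸ 1) / c)) edge-count) (ceiling b b<c))
  where
  open ≡-Reasoning
  c = suc s
  q≡1 : (c + b) / c ≡ 1
  q≡1 = trans ([n+m]/n≡1+m/n c b) (cong suc (m<n⇒m/n≡0 b<c))
  isolated-count : c + c * ((c + b) / c) ∸ (c + b) ≡ c ∸ b
  isolated-count = begin
    c + c * ((c + b) / c) ∸ (c + b) ≡⟨ cong (λ q → c + c * q ∸ (c + b)) q≡1 ⟩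
    c + c * 1 ∸ (c + b)             ≡⟨ cong (λ k → c + k ∸ (c + b)) (*-identityʳ c) ⟩
    c + c ∸ (c + b)                 ≡⟨ [m+n]∸[m+o]≡n∸o c c b ⟩
    c ∸ b                           ∎
  edge-count : c + b ∸ c * ((c + b) / c) ≡ b
  edge-count = begin
    c + b ∸ c * ((c + b) / c) ≡⟨ cong (λ q → c + b ∸ c * q) q≡1 ⟩
    c + b ∸ c * 1             ≡⟨ cong (c + b ∸_) (*-identityʳ c) ⟩
    c + b ∸ c                 ≡⟨ m+n∸m≡n c b ⟩
    b                         ∎
  regroup : ∀ s b′ → s + suc b′ + suc s ≡ suc s + (suc s + b′)
  regroup = solve-∀
  ceiling : ∀ b → b < c → replicate b ((c + b + c ∸ 1) / c) ≡ replicate b 2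
  ceiling zero     _   = refl
  ceiling (suc b′) b<c = cong (replicate (suc b′)) (begin
    (c + suc b′ + c ∸ 1) / c ≡⟨ cong (_/ c) (regroup s b′) ⟩
    (c + (c + b′)) / c       ≡⟨ [n+m]/n≡1+m/n c (c + b′) ⟩
    suc ((c + b′) / c)       ≡⟨ cong suc ([n+m]/n≡1+m/n c b′) ⟩
    suc (suc (b′ / c))       ≡⟨ cong (λ q → suc (suc q)) (m<n⇒m/n≡0 (<-trans (n<1+n b′) b<c)) ⟩
    2                        ∎)
... | inj₂ refl = trans (cong₂ _++_ (cong₂ replicate isolated-count q≡2)
                                   (cong (λ k → replicate k ((c + c + c ∸ 1) / c)) edge-count))
                        (trans (++-identityʳ (replicate c 2)) (cong (λ a → matchingLengths a c) (sym (n∸n≡0 c))))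
  where
  open ≡-Reasoning
  c = suc s
  q≡2 : (c + c) / c ≡ 2
  q≡2 = trans ([n+m]/n≡1+m/n c c) (cong suc (n/n≡1 c))
  c*2≡c+c : c * 2 ≡ c + c
  c*2≡c+c = trans (*-comm c 2) (cong (c +_) (+-identityʳ c))
  isolated-count : c + c * ((c + c) / c) ∸ (c + c) ≡ c
  isolated-count = begin
    c + c * ((c + c) / c) ∸ (c + c) ≡⟨ cong (λ q → c + c * q ∸ (c + c)) q≡2 ⟩
    c + c * 2 ∸ (c + c)             ≡⟨ cong (λ k → c + k ∸ (c + c)) c*2≡c+c ⟩
    c + (c + c) ∸ (c + c)           ≡⟨ m+n∸n≡m c (c + c) ⟩
    c                               ∎
  edge-count : c + c ∸ c * ((c + c) / c) ≡ 0
  edge-count = begin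
    c + c ∸ c * ((c + c) / c) ≡⟨ cong (λ q → c + c ∸ c * q) q≡2 ⟩
    c + c ∸ c * 2             ≡⟨ cong (c + c ∸_) c*2≡c+c ⟩
    c + c ∸ (c + c)           ≡⟨ n∸n≡0 (c + c) ⟩
    0                         ∎

module _ (n s : ℕ) (n∸2≤2s : n ∸ 2 ≤ 2 * s) (s+1≤n : s + 1 ≤ n) where

  private
    b = n ∸ s ∸ 1

    1+s+b≡n : suc s + b ≡ n
    1+s+b≡n = trans (cong₂ _+_ (+-comm 1 s) (∸-+-assoc n s 1)) (m+[n∸m]≡n s+1≤n)

    b≤1+s : b ≤ suc s
    b≤1+s = subst (_≤ suc s) (sym (∸-+-assoc n s 1)) (m≤n+o⇒m∸n≤o n (s + 1) (begin
      n                  ≤⟨ m≤n+m∸n n 2 ⟩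
      2 + (n ∸ 2)        ≤⟨ +-monoʳ-≤ 2 n∸2≤2s ⟩
      2 + 2 * s          ≡⟨ regroup s ⟩
      s + 1 + suc s      ∎))
      where
      open ≤-Reasoning
      regroup : ∀ s → 2 + 2 * s ≡ s + 1 + suc s
      regroup = solve-∀

  PLengths≡matchingLengths : PLengths n (suc s) ≡ matchingLengths (suc s ∸ (n ∸ s ∸ 1)) (n ∸ s ∸ 1)
  PLengths≡matchingLengths =
    subst (λ m → PLengths m (suc s) ≡ matchingLengths (suc s ∸ b) b) 1+s+b≡n (PLengths-matchingLengths s b b≤1+s)

  order-P : sum (PLengths n (suc s)) ≡ n
  order-P = begin
    sum (PLengths n (suc s))            ≡⟨ cong sum PLengths≡matchingLengths ⟩
    sum (matchingLengths (suc s ∸ b) b) ≡⟨ sum-matchingLengths (suc s ∸ b) b ⟩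
    suc s ∸ b + 2 * b                   ≡⟨ cong (suc s ∸ b +_) (cong (b +_) (+-identityʳ b)) ⟩
    suc s ∸ b + (b + b)                 ≡⟨ +-assoc (suc s ∸ b) b b ⟨
    suc s ∸ b + b + b                   ≡⟨ cong (_+ b) (m∸n+n≡m b≤1+s) ⟩
    suc s + b                           ≡⟨ 1+s+b≡n ⟩
    n                                   ∎
    where open ≡-Reasoning

matching-minimises-walks : ∀ {m n} (M : Graph m) (H : Graph n) → MaxDegree≤1 M → degreeSum M ≡ degreeSum H →
                           ∀ k → w (suc k) M ≤ w (suc k) H
matching-minimises-walks M H maxDegree≤1 M≡H k = begin
  w (suc k) M   ≤⟨ w≤degreeSum M maxDegree≤1 k ⟩
  degreeSum M   ≡⟨ M≡H ⟩
  degreeSum H   ≤⟨ degreeSum≤w H k ⟩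
  w (suc k) H   ∎
  where open ≤-Reasoning

matching-strictly-minimises-walks : ∀ {m n} (M : Graph m) (H : Graph n) → m ≡ n → MaxDegree≤1 M →
                                    degreeSum M ≡ degreeSum H → ¬ (H ≅ M) → ∀ k → w (2 + k) M < w (2 + k) H
matching-strictly-minimises-walks {n = n} M H refl maxDegree≤1 M≡H H≇M k with any? (λ v → 2 ≤? degree H v)
... | yes (v , 2≤degree) = ≤-<-trans (≤-trans (w≤degreeSum M maxDegree≤1 (suc k)) (≤-reflexive M≡H))
                                     (degreeSum<w H v 2≤degree k)
... | no  no-branching   = ⊥-elim (H≇M (matchings-≅ n H M H-maxDegree≤1 maxDegree≤1 (sym M≡H)))
  where
  H-maxDegree≤1 : MaxDegree≤1 H
  H-maxDegree≤1 v = ≤-pred (≰⇒> (λ 2≤degree → no-branching (v , 2≤degree)))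

lemma3p2 : (n s : ℕ) → n ∸ 2 ≤ 2 * s → s + 1 ≤ n →
    (H₀ : Graph n) → edgeCount H₀ ≡ n ∸ s ∸ 1 →
    ((k : ℕ) → 1 ≤ k → w k (P n (suc s)) ≤ w k H₀)
    × (¬ (H₀ ≅ P n (suc s)) → (k : ℕ) → 2 ≤ k → w k (P n (suc s)) < w k H₀)
lemma3p2 n s n∸2≤2s s+1≤n H₀ H₀-edges = minimal , strictly-minimal
  where
  b = n ∸ s ∸ 1
  shape = PLengths≡matchingLengths n s n∸2≤2s s+1≤n

  P-maxDegree≤1 : MaxDegree≤1 (P n (suc s))
  P-maxDegree≤1 = subst (MaxDegree≤1 ∘ pathForest) (sym shape) (matchingLengths-maxDegree≤1 (suc s ∸ b) b)

  P≡H₀ : degreeSum (P n (suc s)) ≡ degreeSum H₀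
  P≡H₀ = begin
    degreeSum (P n (suc s)) ≡⟨ subst (λ ls → degreeSum (pathForest ls) ≡ 2 * b) (sym shape)
                                     (matchingLengths-degreeSum (suc s ∸ b) b) ⟩
    2 * b                   ≡⟨ cong (2 *_) H₀-edges ⟨
    2 * edgeCount H₀        ≡⟨ handshake H₀ ⟨
    degreeSum H₀            ∎
    where open ≡-Reasoning

  minimal : (k : ℕ) → 1 ≤ k → w k (P n (suc s)) ≤ w k H₀
  minimal (suc k) _ = matching-minimises-walks (P n (suc s)) H₀ P-maxDegree≤1 P≡H₀ k

  strictly-minimal : ¬ (H₀ ≅ P n (suc s)) → (k : ℕ) → 2 ≤ k → w k (P n (suc s)) < w k H₀
  strictly-minimal H₀≇P (suc zero)    (s≤s ())
  strictly-minimal H₀≇P (suc (suc k)) _ =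
    matching-strictly-minimises-walks (P n (suc s)) H₀ (order-P n s n∸2≤2s s+1≤n) P-maxDegree≤1 P≡H₀ H₀≇P k
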